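{- Let $R;\emptyset\vdash\mathbf M:(A,e)$ be a typable closed program of $\lambda_{\mathrm{cES}}$ which is in normal form for $\to$. Then $\mathbf M$ is of the form $\sum_{i=1}^n(M^i_1\parallel\dots\parallel M^i_{l_i})$ where each $M^i_j$ is either a value or a term generated by the grammar $M_{\mathrm{norm}} ::= \mathrm{get}(r)\mid (M_{\mathrm{norm}}\,V)[\mathcal V]_\lambda \mid (V\,M_{\mathrm{norm}})[\mathcal V]_\lambda \mid (M_{\mathrm{norm}}\,M_{\mathrm{norm}})[\mathcal V]_\lambda$ (with $V$ ranging over values and $\mathcal V$ over reference substitutions).
   Context: The calculus $\lambda_{\mathrm{cES}}$. Variables $x,y,\dots$; references $r,s,\dots$. A variable substitution $\sigma$ is a finite partial map from variables to values; a reference substitution $\mathcal{V}$ is a finite partial map from references to finite multisets of values. Syntax: values $V ::= x \mid \ast \mid \lambda x.M$; terms $M ::= V \mid M\langle\sigma\rangle \mid (M\,M)[\mathcal{V}]_\lambda \mid \mathrm{get}(r) \mid M[\mathcal{V}]_\downarrow \mid M[\mathcal{V}]_\uparrow \mid M\parallel M$; sums $\mathbf{M} ::= \mathbf{0}\mid M \mid \mathbf{M}+\mathbf{M}$. $(M\,N)$ abbreviates $(M\,N)[\emptyset]_\lambda$. Terms are taken modulo $\alpha$-equivalence and: $\parallel$ associative and commutative; $+$ associative, commutative, idempotent, with neutral $\mathbf 0$. Notations: $x\{\sigma\}=\sigma(x)$ if defined, else $x$; $\ast\{\sigma\}=\ast$; $(\lambda x.M)\{\sigma\}=\lambda x.(M\langle\sigma\rangle)$;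 $\mathcal V\{\sigma\}: r\mapsto[V\{\sigma\}\mid V\in\mathcal V(r)]$; $(\mathcal U,\mathcal V)(r)=\mathcal U(r)+\mathcal V(r)$ (multiset union) when both defined, else the defined one; $(\sigma,\tau)(x)=\sigma(x)\{\tau\}$ if both defined, otherwise whichever is defined. Contexts: $E ::= [\cdot] \mid (E\,M)[\mathcal V]_\lambda \mid (M\,E)[\mathcal V]_\lambda \mid E[\mathcal V]_\downarrow \mid E[\mathcal V]_\uparrow$; $C ::= [\cdot]\mid C\parallel M\mid M\parallel C$; $S ::= [\cdot]\mid S+\mathbf M\mid \mathbf M+S$. Reduction $\to$ (closed under the structural equations): base rules ($\beta_v$) $((\lambda x.M)\,V)[\mathcal U]_\lambda \to (M\langle x\mapsto V\rangle)[\mathcal U]_\downarrow$; $x\langle\sigma\rangle\to x\{\sigma\}$; $\ast\langle\sigma\rangle\to\ast$; $((M\,N)[\mathcal V]_\lambda)\langle\sigma\rangle\to (M\langle\sigma\rangle\,N\langle\sigma\rangle)[\mathcal V\{\sigma\}]_\lambda$; $(\lambda y.M)\langle\sigma\rangle\to\lambda y.(M\langle\sigma\rangle)$; $\mathrm{get}(r)\langle\sigma\rangle\to\mathrm{get}(r)$; $(M\parallel M')\langle\sigma\rangle\to M\langle\sigma\rangle\parallel M'\langle\sigma\rangle$; $(M[\mathcal V]_\downarrow)\langle\sigma\rangle\to (M\langle\sigma\rangle)[\mathcal V\{\sigma\}]_\downarrow$; $(M[\mathcal V]_\uparrow)\langle\sigma\rangle\to (M\langle\sigma\rangle)[\mathcal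 V\{\sigma\}]_\uparrow$; $M\langle\sigma\rangle\langle\tau\rangle\to M\langle\sigma,\tau\rangle$; $V[\mathcal V]_\downarrow\to V$; $(M\parallel M')[\mathcal V]_\downarrow\to M[\mathcal V]_\downarrow\parallel M'[\mathcal V]_\downarrow$; $(M[\mathcal U]_\uparrow)[\mathcal V]_\downarrow\to (M[\mathcal V]_\downarrow)[\mathcal U]_\uparrow$; $(M[\mathcal U]_\downarrow)[\mathcal V]_\downarrow\to M[\mathcal U,\mathcal V]_\downarrow$; $((M\,N)[\mathcal U]_\lambda)[\mathcal V]_\downarrow\to (M[\mathcal V]_\downarrow\,N[\mathcal V]_\downarrow)[\mathcal U,\mathcal V]_\lambda$; $(M[\mathcal V]_\uparrow)\parallel N\to (M\parallel N[\mathcal V]_\downarrow)[\mathcal V]_\uparrow$; $((M[\mathcal V]_\uparrow)\,N)[\mathcal U]_\lambda\to ((M\,N[\mathcal V]_\downarrow)[\mathcal U,\mathcal V]_\lambda)[\mathcal V]_\uparrow$; $(M\,(N[\mathcal V]_\uparrow))[\mathcal U]_\lambda\to ((M[\mathcal V]_\downarrow\,N)[\mathcal U,\mathcal V]_\lambda)[\mathcal V]_\uparrow$. If $M\to M'$ by a base rule then $S[C[E[M]]]\to S[C[E[M']]]$. Additionally $S[C[E[\mathrm{get}(r)[\mathcal V]_\downarrow]]]\to S[C[E[\mathrm{get}(r)]]]+\sum_{V\in\mathcal V(r)}C[E[V]]$ (empty sum is $\mathbf 0$), and $S[M[\mathcal V]_\uparrow]\to S[M]$. Types: effects $e$ finite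 sets of references; $\alpha ::= \mathbf B\mid A$; value types $A ::= \mathrm{Unit}\mid A\xrightarrow{e}\alpha\mid \mathrm{Ref}_r A$. Reference contexts $R$ (ordered lists $r_i:A_i$), variable contexts $\Gamma$. Well-formedness: $\emptyset\vdash$; $R\vdash A$, $r\notin\mathrm{dom}(R)$ give $R,r:A\vdash$; $R\vdash$ gives $R\vdash\mathrm{Unit}$, $R\vdash\mathbf B$; $R\vdash A$, $R\vdash\alpha$, $e\subseteq\mathrm{dom}(R)$ give $R\vdash A\xrightarrow{e}\alpha$; $R\vdash$, $r:A\in R$ give $R\vdash\mathrm{Ref}_rA$; $R\vdash\Gamma$ means all types in $\Gamma$ well formed under $R$. Subtyping: reflexivity; $R\vdash A'\le A$ and $R\vdash(\alpha,e)\le(\alpha',e')$ give $R\vdash A\xrightarrow{e}\alpha\le A'\xrightarrow{e'}\alpha'$; $e\subseteq e'\subseteq\mathrm{dom}(R)$ and $R\vdash\alpha\le\alpha'$ give $R\vdash(\alpha,e)\le(\alpha',e')$. Typing rules: (var) $R\vdash\Gamma,x:A$ gives $R;\Gamma,x:A\vdash x:(A,\emptyset)$; (unit) $R\vdash\Gamma$ gives $\ast:(\mathrm{Unit},\emptyset)$; (reg) $R\vdash\Gamma$, $r:A\in R$ give $R;\Gamma\vdash r:\mathrm{Ref}_rA$; (lam) $R;\Gamma,x:A\vdash M:(\alpha,e)$ gives $\lambda x.M:(A\xrightarrow{e}\alpha,\emptyset)$; (get) $R;\Gamma\vdash r:\mathrm{Ref}_rA$ gives $\mathrm{get}(r):(A,\{r\})$;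 (sub) subsumption along $\le$; (subst) from $R;\Gamma,x_1:A_1,\dots,x_n:A_n\vdash M:(\alpha,e)$ and $R;\Gamma\vdash V_i:(A_i,\emptyset)$ infer $M\langle x_i\mapsto V_i\rangle:(\alpha,e)$; (subst-r) for $\xi\in\{\uparrow,\downarrow,\lambda\}$: from $R;\Gamma\vdash r_i:\mathrm{Ref}_{r_i}A_i$ for each $r_i\in\mathrm{dom}(\mathcal V)$, $R;\Gamma\vdash M:(\alpha,e)$, $r_i\in e$, and $R;\Gamma\vdash V:(A_i,\emptyset)$ for all $V\in\mathcal V(r_i)$ infer $M[\mathcal V]_\xi:(\alpha,e)$, where for $\xi=\lambda$, $M=(M_1\,M_2)$ is typed by (app): $M_1:(A\xrightarrow{e_1}\alpha,e_2)$ and $M_2:(A,e_3)$ give $(M_1\,M_2):(\alpha,e_1\cup e_2\cup e_3)$ (always combined with (subst-r) for $\xi=\lambda$); (par) $M_i:(\alpha_i,e_i)$ give $M_1\parallel M_2:(\mathbf B,e_1\cup e_2)$; (sum) $\mathbf M_i:(\alpha,e)$ give $\mathbf M_1+\mathbf M_2:(\alpha,e)$. -}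

module Defs where

open import Data.Nat using (ℕ; _≟_)
open import Data.Bool using (Bool; true; false; if_then_else_)
open import Data.Maybe using (Maybe; just; nothing)
open import Data.Product using (Σ; ∃; _×_; _,_; proj₁; proj₂)
open import Data.Sum using (_⊎_)
open import Data.List using (List; []; _∷_; _++_; map; concatMap)
open import Data.List.NonEmpty using (List⁺; _∷_)
open import Data.List.Relation.Unary.All using (All)
open import Data.List.Relation.Unary.Any using (Any)
open import Data.List.Membership.Propositional using (_∈_)
open import Data.List.Relation.Binary.Subset.Propositional using (_⊆_)
open import Relation.Nullary using (¬_; does)
open import Relation.Binary.PropositionalEquality using (_≡_)

Var : Set
Var = ℕ

Ref : Set
Ref = ℕ

-- A variable substitution σ (finite partial map Var ⇀ Val) is a list of
-- bindings; lookup takes the first binding (later ones are shadowed).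
-- A reference substitution 𝒱 (finite partial map Ref ⇀ finite multiset of
-- values) is a list of entries (r , vs); 𝒱(r) is the multiset union of all
-- entries with key r, and dom 𝒱 is the set of keys.  Hence the union
-- (𝒰 , 𝒱) of the paper is list concatenation.

mutual
  data Val : Set where
    var  : Var → Val
    unit : Val
    lam  : Var → Term → Val

  data Term : Set where
    val  : Val → Term
    esub : Term → List (Var × Val) → Term
    app  : Term → Term → List (Ref × List Val) → Term     -- (M N)[𝒱]_λ
    get  : Ref → Term
    down : Term → List (Ref × List Val) → Term
    up   : Term → List (Ref × List Val) → Term
    _∥_  : Term → Term → Term

infixr 5 _∥_

VSubst : Set
VSubst = List (Var × Val)

RSubst : Set
RSubst = List (Ref × List Val)

-- sums: 0 is [], 𝐌 + 𝐍 is _++_ (ACI taken care of by _≈s_ below)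
Sum : Set
Sum = List Term

lookupσ : VSubst → Var → Maybe Val
lookupσ [] x = nothing
lookupσ ((y , V) ∷ σ) x = if does (y ≟ x) then just V else lookupσ σ x

lookupR : RSubst → Ref → List Val
lookupR [] r = []
lookupR ((s , vs) ∷ 𝒱) r = if does (s ≟ r) then vs ++ lookupR 𝒱 r else lookupR 𝒱 r

_∈dom_ : Ref → RSubst → Set
r ∈dom 𝒱 = Any (λ p → proj₁ p ≡ r) 𝒱

_⟪_⟫ : Val → VSubst → Val
var x ⟪ σ ⟫ with lookupσ σ x
... | just V  = V
... | nothing = var x
unit ⟪ σ ⟫ = unit
lam x M ⟪ σ ⟫ = lam x (esub M σ)

_⟪_⟫R : RSubst → VSubst → RSubst
𝒱 ⟪ σ ⟫R = map (λ p → proj₁ p , map (_⟪ σ ⟫) (proj₂ p)) 𝒱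

-- (σ , τ):  σ(x){τ} if σ(x), τ(x) both defined, otherwise whichever is defined
compose : VSubst → VSubst → VSubst
compose σ τ = map f σ ++ τ
  where
  f : Var × Val → Var × Val
  f (x , V) with lookupσ τ x
  ... | just _  = x , V ⟪ τ ⟫
  ... | nothing = x , V

mutual
  data _≈_ : Term → Term → Set where
    ≈-refl  : ∀ {M} → M ≈ M
    ≈-sym   : ∀ {M N} → M ≈ N → N ≈ M
    ≈-trans : ∀ {M N P} → M ≈ N → N ≈ P → M ≈ P
    ∥-comm  : ∀ {M N} → (M ∥ N) ≈ (N ∥ M)
    ∥-assoc : ∀ {M N P} → ((M ∥ N) ∥ P) ≈ (M ∥ (N ∥ P))
    val-cong  : ∀ {V W} → V ≈v W → val V ≈ val W
    esub-cong : ∀ {M M' σ τ} → M ≈ M' → σ ≈σ τ → esub M σ ≈ esub M' τ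
    app-cong  : ∀ {M M' N N' 𝒰 𝒱} → M ≈ M' → N ≈ N' → 𝒰 ≈R 𝒱 → app M N 𝒰 ≈ app M' N' 𝒱
    down-cong : ∀ {M M' 𝒰 𝒱} → M ≈ M' → 𝒰 ≈R 𝒱 → down M 𝒰 ≈ down M' 𝒱
    up-cong   : ∀ {M M' 𝒰 𝒱} → M ≈ M' → 𝒰 ≈R 𝒱 → up M 𝒰 ≈ up M' 𝒱
    ∥-cong    : ∀ {M M' N N'} → M ≈ M' → N ≈ N' → (M ∥ N) ≈ (M' ∥ N')

  data _≈v_ : Val → Val → Set where
    var-refl  : ∀ {x} → var x ≈v var x
    unit-refl : unit ≈v unit
    lam-cong  : ∀ {x M M'} → M ≈ M' → lam x M ≈v lam x M'

  data LookupRel : Maybe Val → Maybe Val → Set where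
    none : LookupRel nothing nothing
    some : ∀ {V W} → V ≈v W → LookupRel (just V) (just W)

  data _≈σ_ (σ τ : VSubst) : Set where
    σ-eq : (∀ x → LookupRel (lookupσ σ x) (lookupσ τ x)) → σ ≈σ τ

  -- equal as multisets (up to ≈ on values)
  data MSetRel : List Val → List Val → Set where
    ms-[] : MSetRel [] []
    ms-∷  : ∀ {V W vs ws₁ ws₂} → V ≈v W → MSetRel vs (ws₁ ++ ws₂) →
            MSetRel (V ∷ vs) (ws₁ ++ W ∷ ws₂)

  data _≈R_ (𝒰 𝒱 : RSubst) : Set where
    R-eq : (∀ r → ((r ∈dom 𝒰 → r ∈dom 𝒱) × (r ∈dom 𝒱 → r ∈dom 𝒰))
                  × MSetRel (lookupR 𝒰 r) (lookupR 𝒱 r)) → 𝒰 ≈R 𝒱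

-- equality of sums modulo assoc., comm., idempotence, neutral 0, and ≈
_≈s_ : Sum → Sum → Set
𝐌 ≈s 𝐍 = All (λ M → Any (M ≈_) 𝐍) 𝐌 × All (λ N → Any (_≈ N) 𝐌) 𝐍

data ECtx : Set where
  hole  : ECtx
  appL  : ECtx → Term → RSubst → ECtx
  appR  : Term → ECtx → RSubst → ECtx
  downE : ECtx → RSubst → ECtx
  upE   : ECtx → RSubst → ECtx

plugE : ECtx → Term → Term
plugE hole M = M
plugE (appL E N 𝒱) M = app (plugE E M) N 𝒱
plugE (appR N E 𝒱) M = app N (plugE E M) 𝒱
plugE (downE E 𝒱) M = down (plugE E M) 𝒱
plugE (upE E 𝒱) M = up (plugE E M) 𝒱

data CCtx : Set where
  hole : CCtx
  parL : CCtx → Term → CCtx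
  parR : Term → CCtx → CCtx

plugC : CCtx → Term → Term
plugC hole M = M
plugC (parL C N) M = plugC C M ∥ N
plugC (parR N C) M = N ∥ plugC C M

data _↦_ : Term → Term → Set where
  βv        : ∀ {x M V 𝒰} → app (val (lam x M)) (val V) 𝒰 ↦ down (esub M ((x , V) ∷ [])) 𝒰
  s-var     : ∀ {x σ} → esub (val (var x)) σ ↦ val (var x ⟪ σ ⟫)
  s-unit    : ∀ {σ} → esub (val unit) σ ↦ val unit
  s-app     : ∀ {M N 𝒱 σ} → esub (app M N 𝒱) σ ↦ app (esub M σ) (esub N σ) (𝒱 ⟪ σ ⟫R)
  s-lam     : ∀ {y M σ} → esub (val (lam y M)) σ ↦ val (lam y (esub M σ))
  s-get     : ∀ {r σ} → esub (get r) σ ↦ get r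
  s-par     : ∀ {M M' σ} → esub (M ∥ M') σ ↦ (esub M σ ∥ esub M' σ)
  s-down    : ∀ {M 𝒱 σ} → esub (down M 𝒱) σ ↦ down (esub M σ) (𝒱 ⟪ σ ⟫R)
  s-up      : ∀ {M 𝒱 σ} → esub (up M 𝒱) σ ↦ up (esub M σ) (𝒱 ⟪ σ ⟫R)
  s-comp    : ∀ {M σ τ} → esub (esub M σ) τ ↦ esub M (compose σ τ)
  d-val     : ∀ {V 𝒱} → down (val V) 𝒱 ↦ val V
  d-par     : ∀ {M M' 𝒱} → down (M ∥ M') 𝒱 ↦ (down M 𝒱 ∥ down M' 𝒱)
  d-up      : ∀ {M 𝒰 𝒱} → down (up M 𝒰) 𝒱 ↦ up (down M 𝒱) 𝒰
  d-down    : ∀ {M 𝒰 𝒱} → down (down M 𝒰) 𝒱 ↦ down M (𝒰 ++ 𝒱)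
  d-app     : ∀ {M N 𝒰 𝒱} → down (app M N 𝒰) 𝒱 ↦ app (down M 𝒱) (down N 𝒱) (𝒰 ++ 𝒱)
  u-par     : ∀ {M N 𝒱} → (up M 𝒱 ∥ N) ↦ up (M ∥ down N 𝒱) 𝒱
  u-appL    : ∀ {M N 𝒰 𝒱} → app (up M 𝒱) N 𝒰 ↦ up (app M (down N 𝒱) (𝒰 ++ 𝒱)) 𝒱
  u-appR    : ∀ {M N 𝒰 𝒱} → app M (up N 𝒱) 𝒰 ↦ up (app (down M 𝒱) N (𝒰 ++ 𝒱)) 𝒱

-- reduction on (representatives of) sums;  S[·] is  xs ++ [·] ++ ys
data _⟶ₛ_ : Sum → Sum → Set where
  base  : ∀ {xs ys C E M M'} → M ↦ M' →
          (xs ++ plugC C (plugE E M) ∷ ys) ⟶ₛ (xs ++ plugC C (plugE E M') ∷ ys)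
  get-r : ∀ {xs ys C E r 𝒱} →
          (xs ++ plugC C (plugE E (down (get r) 𝒱)) ∷ ys) ⟶ₛ
          ((xs ++ plugC C (plugE E (get r)) ∷ ys)
            ++ map (λ V → plugC C (plugE E (val V))) (lookupR 𝒱 r))
  up-r  : ∀ {xs ys M 𝒱} → (xs ++ up M 𝒱 ∷ ys) ⟶ₛ (xs ++ M ∷ ys)

_⟶_ : Sum → Sum → Set
𝐌 ⟶ 𝐍 = Σ Sum λ 𝐌' → Σ Sum λ 𝐍' → 𝐌 ≈s 𝐌' × 𝐌' ⟶ₛ 𝐍' × 𝐍' ≈s 𝐍

NormalForm : Sum → Set
NormalForm 𝐌 = ∀ 𝐍 → ¬ (𝐌 ⟶ 𝐍)

Eff : Set
Eff = List Ref          -- finite set of references (order/duplicates irrelevant)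

mutual
  data VType : Set where
    Unit : VType
    _⟶[_]_ : VType → Eff → RType → VType
    RefT : Ref → VType → VType

  data RType : Set where
    𝐁  : RType
    ty : VType → RType

-- reference contexts; the head is the most recently added entry
RCtx : Set
RCtx = List (Ref × VType)

domR : RCtx → List Ref
domR R = map proj₁ R

-- variable contexts; the head is the most recently added entry
VCtx : Set
VCtx = List (Var × VType)

lookupΓ : VCtx → Var → Maybe VType
lookupΓ [] x = nothing
lookupΓ ((y , A) ∷ Γ) x = if does (y ≟ x) then just A else lookupΓ Γ x

mutual
  data WfR : RCtx → Set where
    wf-∅ : WfR []
    wf-, : ∀ {R r A} → WfV R A → ¬ (r ∈ domR R) → WfR ((r , A) ∷ R)

  data WfV (R : RCtx) : VType → Set where
    wf-Unit : WfR R → WfV R Unit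
    wf-⟶   : ∀ {A α e} → WfV R A → WfT R α → e ⊆ domR R → WfV R (A ⟶[ e ] α)
    wf-Ref  : ∀ {r A} → WfR R → (r , A) ∈ R → WfV R (RefT r A)

  data WfT (R : RCtx) : RType → Set where
    wf-𝐁  : WfR R → WfT R 𝐁
    wf-ty : ∀ {A} → WfV R A → WfT R (ty A)

WfΓ : RCtx → VCtx → Set
WfΓ R Γ = All (λ p → WfV R (proj₂ p)) Γ

mutual
  data SubV (R : RCtx) : VType → VType → Set where
    ≤-refl : ∀ {A} → SubV R A A
    ≤-⟶   : ∀ {A A' α α' e e'} → SubV R A' A → SubE R α e α' e' →
             SubV R (A ⟶[ e ] α) (A' ⟶[ e' ] α')

  data SubT (R : RCtx) : RType → RType → Set where
    ≤-𝐁  : SubT R 𝐁 𝐁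
    ≤-ty : ∀ {A A'} → SubV R A A' → SubT R (ty A) (ty A')

  data SubE (R : RCtx) : RType → Eff → RType → Eff → Set where
    ≤-eff : ∀ {α α' e e'} → e ⊆ e' → e' ⊆ domR R → SubT R α α' → SubE R α e α' e'

mutual
  data Typed (R : RCtx) : VCtx → Term → RType → Eff → Set where
    t-var   : ∀ {Γ x A} → WfΓ R Γ → lookupΓ Γ x ≡ just A →
              Typed R Γ (val (var x)) (ty A) []
    t-unit  : ∀ {Γ} → WfΓ R Γ → Typed R Γ (val unit) (ty Unit) []
    t-lam   : ∀ {Γ x A M α e} → Typed R ((x , A) ∷ Γ) M α e →
              Typed R Γ (val (lam x M)) (ty (A ⟶[ e ] α)) []
    t-get   : ∀ {Γ r A} → WfΓ R Γ → (r , A) ∈ R → Typed R Γ (get r) (ty A) (r ∷ [])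
    t-sub   : ∀ {Γ M α e α' e'} → Typed R Γ M α e → SubE R α e α' e' → Typed R Γ M α' e'
    t-subst : ∀ {Γ M σ Δ α e} → SubstTyped R Γ σ Δ → Typed R (Δ ++ Γ) M α e →
              Typed R Γ (esub M σ) α e
    t-down  : ∀ {Γ M 𝒱 α e} → Typed R Γ M α e → RSubstOK R Γ 𝒱 e → Typed R Γ (down M 𝒱) α e
    t-up    : ∀ {Γ M 𝒱 α e} → Typed R Γ M α e → RSubstOK R Γ 𝒱 e → Typed R Γ (up M 𝒱) α e
    t-app   : ∀ {Γ M₁ M₂ 𝒱 A α e₁ e₂ e₃} →
              Typed R Γ M₁ (ty (A ⟶[ e₁ ] α)) e₂ → Typed R Γ M₂ (ty A) e₃ →
              RSubstOK R Γ 𝒱 (e₁ ++ e₂ ++ e₃) →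
              Typed R Γ (app M₁ M₂ 𝒱) α (e₁ ++ e₂ ++ e₃)
    t-par   : ∀ {Γ M₁ M₂ α₁ α₂ e₁ e₂} → Typed R Γ M₁ α₁ e₁ → Typed R Γ M₂ α₂ e₂ →
              Typed R Γ (M₁ ∥ M₂) 𝐁 (e₁ ++ e₂)

  -- premises of (subst): σ = [x₁ ↦ V₁, …], Δ = [x₁ : A₁, …], R;Γ ⊢ Vᵢ : (Aᵢ , ∅)
  data SubstTyped (R : RCtx) (Γ : VCtx) : VSubst → VCtx → Set where
    st-[] : SubstTyped R Γ [] []
    st-∷  : ∀ {x V A σ Δ} → Typed R Γ (val V) (ty A) [] → SubstTyped R Γ σ Δ →
            SubstTyped R Γ ((x , V) ∷ σ) ((x , A) ∷ Δ)

  data RSubstOK (R : RCtx) (Γ : VCtx) (𝒱 : RSubst) (e : Eff) : Set where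
    rs-ok : (∀ r → r ∈dom 𝒱 →
               Σ VType λ A → WfΓ R Γ × (r , A) ∈ R × r ∈ e
                 × All (λ V → Typed R Γ (val V) (ty A) []) (lookupR 𝒱 r)) →
            RSubstOK R Γ 𝒱 e

-- R ; ∅ ⊢ 𝐌 : (α , e) for a raw sum (rule (sum); 0 has no typing rule)
TypedSum : RCtx → Sum → RType → Eff → Set
TypedSum R 𝐌 α e = ¬ (𝐌 ≡ []) × All (λ M → Typed R [] M α e) 𝐌

TypableProgram : RCtx → Sum → VType → Eff → Set
TypableProgram R 𝐌 A e = Σ Sum λ 𝐌' → 𝐌 ≈s 𝐌' × TypedSum R 𝐌' (ty A) e

data MNorm : Term → Set where
  n-get : ∀ {r} → MNorm (get r)
  n-MV  : ∀ {M V 𝒱} → MNorm M → MNorm (app M (val V) 𝒱)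
  n-VM  : ∀ {V M 𝒱} → MNorm M → MNorm (app (val V) M 𝒱)
  n-MM  : ∀ {M N 𝒱} → MNorm M → MNorm N → MNorm (app M N 𝒱)

IsValue : Term → Set
IsValue M = Σ Val λ V → M ≡ val V

parList : Term → List Term → Term
parList M [] = M
parList M (N ∷ Ns) = M ∥ parList N Ns

parAll : List⁺ Term → Term
parAll (M ∷ Ms) = parList M Ms

sumPar : List (List⁺ Term) → Sum
sumPar = map parAll

{-# OPTIONS --safe #-}
module Submission where

-- A progress argument for closed typable terms, along evaluation contexts.
-- An explicit substitution M⟨σ⟩ is always a redex, and so is M[𝒱]↓ (or it
-- contains one, get(r)[𝒱]↓ reducing by the get rule); an upward substitution
-- is pushed out of applications and parallel compositions and erased at the
-- top of a summand.  Inside an application, typing rules out parallel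
-- compositions (they have type 𝐁) and forces a closed function value to be a
-- λ, so an application of values is a β-redex.  What survives in a normal
-- form is therefore a parallel composition of values and M_norm terms.

open import Defs
open import Data.Product using (Σ; ∃₂; _×_; _,_; proj₁; proj₂)
open import Data.Sum using (_⊎_; inj₁; inj₂)
open import Data.List using (List; []; _∷_; _++_)
open import Data.List.NonEmpty using (List⁺; _∷_; _⁺++⁺_)
open import Data.List.Relation.Unary.All using (All; []; _∷_)
import Data.List.Relation.Unary.All as All
import Data.List.Relation.Unary.All.Properties as All
open import Data.List.Relation.Unary.Any using (Any; here; there)
import Data.List.Relation.Unary.Any as Any
import Data.List.NonEmpty.Relation.Unary.All as All⁺
open import Data.List.Membership.Propositional using (_∈_)
open import Data.Empty using (⊥-elim)
open import Relation.Nullary using (¬_)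
open import Relation.Binary.PropositionalEquality using (_≡_; refl)

≈s-∷ : ∀ {T T' 𝐋 𝐍} → T ≈ T' → 𝐋 ≈s 𝐍 → (T ∷ 𝐋) ≈s (T' ∷ 𝐍)
≈s-∷ T≈T' (𝐋⊑𝐍 , 𝐍⊑𝐋) = here T≈T' ∷ All.map there 𝐋⊑𝐍 , here T≈T' ∷ All.map there 𝐍⊑𝐋

≈s-refl : ∀ 𝐋 → 𝐋 ≈s 𝐋
≈s-refl [] = [] , []
≈s-refl (T ∷ 𝐋) = ≈s-∷ ≈-refl (≈s-refl 𝐋)

≈s-trans : ∀ {𝐋 𝐌 𝐍} → 𝐋 ≈s 𝐌 → 𝐌 ≈s 𝐍 → 𝐋 ≈s 𝐍
≈s-trans (𝐋⊑𝐌 , 𝐌⊒𝐋) (𝐌⊑𝐍 , 𝐍⊒𝐌) =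
  All.map (λ T≈ → right T≈ 𝐌⊑𝐍) 𝐋⊑𝐌 , All.map (λ ≈T → left ≈T 𝐌⊒𝐋) 𝐍⊒𝐌
  where
  right : ∀ {T 𝐌 𝐍} → Any (T ≈_) 𝐌 → All (λ M → Any (M ≈_) 𝐍) 𝐌 → Any (T ≈_) 𝐍
  right (here T≈M) (M≈ ∷ _) = Any.map (≈-trans T≈M) M≈
  right (there T≈) (_ ∷ 𝐌⊑𝐍) = right T≈ 𝐌⊑𝐍

  left : ∀ {T 𝐌 𝐍} → Any (_≈ T) 𝐌 → All (λ M → Any (_≈ M) 𝐍) 𝐌 → Any (_≈ T) 𝐍
  left (here M≈T) (≈M ∷ _) = Any.map (λ N≈M → ≈-trans N≈M M≈T) ≈M
  left (there ≈T) (_ ∷ 𝐌⊒𝐍) = left ≈T 𝐌⊒𝐍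

≈s-insert : ∀ {T T' 𝐋} → T ∈ 𝐋 → T ≈ T' → 𝐋 ≈s (T' ∷ 𝐋)
≈s-insert {𝐋 = 𝐋} T∈𝐋 T≈T' =
  All.map there (proj₁ (≈s-refl 𝐋)) , Any.map (λ { refl → T≈T' }) T∈𝐋 ∷ proj₂ (≈s-refl 𝐋)

Typable : RCtx → VCtx → Term → Set
Typable R Γ M = Σ RType λ α → Σ Eff λ e → Typed R Γ M α e

module _ {R : RCtx} where

  par-not-value-typed : ∀ {Γ L M A e} → ¬ Typed R Γ (L ∥ M) (ty A) e
  par-not-value-typed (t-sub ⊢L∥M (≤-eff _ _ (≤-ty _))) = par-not-value-typed ⊢L∥M

  par-inv : ∀ {Γ L M α e} → Typed R Γ (L ∥ M) α e → Typable R Γ L × Typable R Γ M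
  par-inv (t-par ⊢L ⊢M) = (_ , _ , ⊢L) , (_ , _ , ⊢M)
  par-inv (t-sub ⊢L∥M _) = par-inv ⊢L∥M

  canonical-arrow : ∀ {V A e₁ α e} → Typed R [] (val V) (ty (A ⟶[ e₁ ] α)) e →
                    ∃₂ λ x M → V ≡ lam x M
  canonical-arrow (t-var _ ())
  canonical-arrow (t-lam _) = _ , _ , refl
  canonical-arrow (t-sub ⊢V (≤-eff _ _ (≤-ty ≤-refl))) = canonical-arrow ⊢V
  canonical-arrow (t-sub ⊢V (≤-eff _ _ (≤-ty (≤-⟶ _ _)))) = canonical-arrow ⊢V

data Redex : Term → Set where
  base     : ∀ {X X'} → X ↦ X' → Redex X
  get-down : ∀ {r 𝒱} → Redex (down (get r) 𝒱)

data Shape : Term → Set where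
  value    : ∀ V → Shape (val V)
  normal   : ∀ {M} → MNorm M → Shape M
  redex    : ∀ E {X} → Redex X → Shape (plugE E X)
  lifted   : ∀ M 𝒱 → Shape (up M 𝒱)
  parallel : ∀ L M → Shape (L ∥ M)

esub-redex : ∀ M σ → Redex (esub M σ)
esub-redex (val (var x)) σ = base s-var
esub-redex (val unit) σ = base s-unit
esub-redex (val (lam y M)) σ = base s-lam
esub-redex (esub M τ) σ = base s-comp
esub-redex (app M N 𝒱) σ = base s-app
esub-redex (get r) σ = base s-get
esub-redex (down M 𝒱) σ = base s-down
esub-redex (up M 𝒱) σ = base s-up
esub-redex (L ∥ M) σ = base s-par

down-shape : ∀ M 𝒱 → Shape (down M 𝒱)
down-shape (val V) 𝒱 = redex hole (base d-val)
down-shape (esub M σ) 𝒱 = redex (downE hole 𝒱) (esub-redex M σ)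
down-shape (app M N 𝒰) 𝒱 = redex hole (base d-app)
down-shape (get r) 𝒱 = redex hole get-down
down-shape (down M 𝒰) 𝒱 = redex hole (base d-down)
down-shape (up M 𝒰) 𝒱 = redex hole (base d-up)
down-shape (L ∥ M) 𝒱 = redex hole (base d-par)

module _ {R : RCtx} where

  app-shape : ∀ {M N 𝒱 A e₁ α e₂ e₃} →
              Typed R [] M (ty (A ⟶[ e₁ ] α)) e₂ → Typed R [] N (ty A) e₃ →
              Shape M → Shape N → Shape (app M N 𝒱)
  app-shape _ _ (redex E r) _ = redex (appL E _ _) r
  app-shape _ _ (lifted _ _) _ = redex hole (base u-appL)
  app-shape ⊢M _ (parallel _ _) _ = ⊥-elim (par-not-value-typed ⊢M)
  app-shape _ _ _ (redex E r) = redex (appR _ E _) r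
  app-shape _ _ _ (lifted _ _) = redex hole (base u-appR)
  app-shape _ ⊢N _ (parallel _ _) = ⊥-elim (par-not-value-typed ⊢N)
  app-shape ⊢M _ (value V) (value W) with canonical-arrow ⊢M
  ... | _ , _ , refl = redex hole (base βv)
  app-shape _ _ (value V) (normal n) = normal (n-VM n)
  app-shape _ _ (normal m) (value W) = normal (n-MV m)
  app-shape _ _ (normal m) (normal n) = normal (n-MM m n)

  shape : ∀ {M α e} → Typed R [] M α e → Shape M
  shape (t-var _ ())
  shape (t-unit _) = value unit
  shape (t-lam _) = value (lam _ _)
  shape (t-get _ _) = normal n-get
  shape (t-sub ⊢M _) = shape ⊢M
  shape (t-subst {M = M} {σ = σ} _ _) = redex hole (esub-redex M σ)
  shape (t-down {M = M} {𝒱 = 𝒱} _ _) = down-shape M 𝒱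
  shape (t-up _ _) = lifted _ _
  shape (t-app ⊢M ⊢N _) = app-shape ⊢M ⊢N (shape ⊢M) (shape ⊢N)
  shape (t-par _ _) = parallel _ _

Component : Term → Set
Component M = IsValue M ⊎ MNorm M

Decomposed : Term → Set
Decomposed T = Σ (List⁺ Term) λ Ms → All⁺.All Component Ms × T ≈ parAll Ms

parList-∥ : ∀ L Ls M Ms → (parList L Ls ∥ parList M Ms) ≈ parList L (Ls ++ M ∷ Ms)
parList-∥ L [] M Ms = ≈-refl
parList-∥ L (L' ∷ Ls) M Ms = ≈-trans ∥-assoc (∥-cong ≈-refl (parList-∥ L' Ls M Ms))

decomposed-∥ : ∀ {L M} → Decomposed L → Decomposed M → Decomposed (L ∥ M)
decomposed-∥ (L ∷ Ls , cL All⁺.∷ cLs , L≈) (M ∷ Ms , cM All⁺.∷ cMs , M≈) =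
  (L ∷ Ls) ⁺++⁺ (M ∷ Ms) , cL All⁺.∷ All.++⁺ cLs (cM ∷ cMs) ,
  ≈-trans (∥-cong L≈ M≈) (parList-∥ L Ls M Ms)

data ParShape (T : Term) : Set where
  components : Decomposed T → ParShape T
  redex      : ∀ C E {X} → Redex X → T ≈ plugC C (plugE E X) → ParShape T
  lifted     : ∀ {M 𝒱} → T ≡ up M 𝒱 → ParShape T

∥-shape : ∀ {L M} → ParShape L → ParShape M → ParShape (L ∥ M)
∥-shape (redex C E r L≈) _ = redex (parL C _) E r (∥-cong L≈ ≈-refl)
∥-shape (lifted refl) _ = redex hole hole (base u-par) ≈-refl
∥-shape _ (redex C E r M≈) = redex (parR _ C) E r (∥-cong ≈-refl M≈)
∥-shape _ (lifted refl) = redex hole hole (base u-par) ∥-comm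
∥-shape (components dL) (components dM) = components (decomposed-∥ dL dM)

module _ {R : RCtx} where

  par-shape : ∀ T → Typable R [] T → ParShape T
  par-shape T (_ , _ , ⊢T) with shape ⊢T
  ... | value V = components (val V ∷ [] , inj₁ (V , refl) All⁺.∷ [] , ≈-refl)
  ... | normal n = components (T ∷ [] , inj₂ n All⁺.∷ [] , ≈-refl)
  ... | redex E r = redex hole E r ≈-refl
  ... | lifted _ _ = lifted refl
  ... | parallel L M with par-inv ⊢T
  ...   | ⊢L , ⊢M = ∥-shape (par-shape L ⊢L) (par-shape M ⊢M)

module _ {𝐌 𝐌' : Sum} (nf : NormalForm 𝐌) (𝐌≈𝐌' : 𝐌 ≈s 𝐌') where

  irreducible-member : ∀ {T T' 𝐍} → T ∈ 𝐌' → T ≈ T' → ¬ ((T' ∷ 𝐌') ⟶ₛ 𝐍)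
  irreducible-member T∈𝐌' T≈T' step =
    nf _ (_ , _ , ≈s-trans 𝐌≈𝐌' (≈s-insert T∈𝐌' T≈T') , step , ≈s-refl _)

  member-decomposed : ∀ {T} → T ∈ 𝐌' → ParShape T → Decomposed T
  member-decomposed _ (components d) = d
  member-decomposed T∈𝐌' (redex C E (base X↦) T≈) =
    ⊥-elim (irreducible-member T∈𝐌' T≈ (base {xs = []} {C = C} {E = E} X↦))
  member-decomposed T∈𝐌' (redex C E get-down T≈) =
    ⊥-elim (irreducible-member T∈𝐌' T≈ (get-r {xs = []} {C = C} {E = E}))
  member-decomposed T∈𝐌' (lifted refl) =
    ⊥-elim (irreducible-member T∈𝐌' ≈-refl (up-r {xs = []}))

sum-of-decomposed : ∀ {𝐋} → All Decomposed 𝐋 →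
  Σ (List (List⁺ Term)) λ Mss → All (All⁺.All Component) Mss × 𝐋 ≈s sumPar Mss
sum-of-decomposed [] = [] , [] , [] , []
sum-of-decomposed ((Ms , cMs , T≈) ∷ ds) with sum-of-decomposed ds
... | Mss , cMss , 𝐋≈ = Ms ∷ Mss , cMs ∷ cMss , ≈s-∷ T≈ 𝐋≈

mainTheorem4 : (R : RCtx) (𝐌 : Sum) (A : VType) (e : Eff) →
    TypableProgram R 𝐌 A e → NormalForm 𝐌 →
    Σ (List (List⁺ Term)) (λ Ms →
      All (All⁺.All (λ M → IsValue M ⊎ MNorm M)) Ms × 𝐌 ≈s sumPar Ms)
mainTheorem4 R 𝐌 A e (𝐌' , 𝐌≈𝐌' , _ , ⊢𝐌') nf =
  let Mss , cMss , 𝐌'≈ = sum-of-decomposed (All.tabulate decompose)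
  in Mss , cMss , ≈s-trans 𝐌≈𝐌' 𝐌'≈
  where
  decompose : ∀ {T} → T ∈ 𝐌' → Decomposed T
  decompose T∈𝐌' =
    member-decomposed nf 𝐌≈𝐌' T∈𝐌' (par-shape _ (_ , _ , All.lookup ⊢𝐌' T∈𝐌'))
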